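{- Fix an integer $k\ge 3$. (1) For every $L_\sigma\in\mathcal{G}'_k$ and every $H\in\mathcal{G}'_k$ whose associated permutation is the $k$-cycle $(1\,2\,\cdots\,k)$, we have $L_\sigma\sim H$; thus $\mathcal{G}_k/\sim$ contains exactly one element. (2) For $L_\sigma\in\mathcal{G}'_k$, there exists a transversal of $L_\sigma$ if and only if there exist $k$ pairwise disjoint transversals of $L_\sigma$. (3) If $k$ is odd and $L\in\mathcal{G}_k$, then there exists $L'\in\mathcal{G}_k$ such that $L$ and $L'$ are orthogonal. (4) If $k$ is even and $L\in\mathcal{G}_k$, then there is no Latin square $L'$ of size $k$ orthogonal to $L$.
   Context: A Latin square of size $k$ is a $k\times k$ array $L=(L_{ij})$ with entries in $\{1,\dots,k\}$ with no repetition in any row or column; $\mathcal{L}_k$ is the set of these. For $i\neq j$, $\sigma^L_{ij}\in\text{Sym}_k$ is the permutation with $\sigma^L_{ij}(L_{ip})=L_{jp}$ for $p=1,\dots,k$. $L\sim L'$ means $L'$ is obtained from $L$ by finitely many of: exchanging two rows, exchanging two columns, exchanging two symbols throughout the square. $\mathcal{G}'_k$ is the set of $L\in\mathcal{L}_k$ such that $\sigma^L_{i,i+1}=\sigma^L_{j,j+1}$ for all $i,j\in\{1,\dots,k-1\}$ and this common permutation is a $k$-cycle; an element of $\mathcal{G}'_k$ with common permutation $\sigma$ is written $L_\sigma$. $\mathcal{G}_k$ is the set of $L\in\mathcal{L}_k$ with $L\sim H$ for some $H\in\mathcal{G}'_k$. A transversal of $L$ is a set of $k$ cells, no two in the same row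 or column, whose entries are pairwise distinct; transversals are disjoint if they share no cell. $L,L'$ are orthogonal if $(i,j)\mapsto(L_{ij},L'_{ij})$ is a bijection of $\{1,\dots,k\}^2$. -}

module Defs where

open import Data.Nat using (ℕ; zero; suc; _^_)
open import Data.Nat.DivMod using (_mod_)
open import Data.Fin using (Fin; toℕ; _≟_)
open import Data.Product using (Σ; ∃; _×_; _,_)
open import Relation.Nullary using (¬_; yes; no)
open import Relation.Binary.PropositionalEquality using (_≡_)
open import Function using (_∘_)
open import Function.Definitions using (Injective; Bijective)

-- A k × k array with entries in Fin k (rows, columns and symbols are
-- indexed 0,…,k-1 instead of 1,…,k).
Square : ℕ → Set
Square k = Fin k → Fin k → Fin k

IsLatin : ∀ {k} → Square k → Set
IsLatin {k} L =
  (∀ (i : Fin k) → Injective _≡_ _≡_ (L i)) ×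
  (∀ (j : Fin k) → Injective _≡_ _≡_ (λ i → L i j))

IsSigma : ∀ {k} → Square k → Fin k → Fin k → (Fin k → Fin k) → Set
IsSigma {k} L i j σ = ∀ (p : Fin k) → σ (L i p) ≡ L j p

iter : ∀ {A : Set} → (A → A) → ℕ → A → A
iter f zero x = x
iter f (suc n) x = f (iter f n x)

-- σ is a k-cycle on Fin k: some x has k distinct iterates x, σx, …, σ^{k-1}x,
-- i.e. σ = (x σx … σ^{k-1}x).
IsKCycle : ∀ {k} → (Fin k → Fin k) → Set
IsKCycle {k} σ = Σ (Fin k) λ x → Injective _≡_ _≡_ (λ (n : Fin k) → iter σ (toℕ n) x)

IsLσ : ∀ {k} → Square k → (Fin k → Fin k) → Set
IsLσ {k} L σ =
  IsLatin L ×
  (∀ (i j : Fin k) → toℕ j ≡ suc (toℕ i) → IsSigma L i j σ) ×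
  IsKCycle σ

InG' : ∀ {k} → Square k → Set
InG' {k} L = Σ (Fin k → Fin k) λ σ → IsLσ L σ

-- The k-cycle (1 2 ⋯ k), in 0-based indexing: i ↦ i+1 mod k.
cyc : (k : ℕ) → Fin k → Fin k
cyc (suc m) i = suc (toℕ i) mod (suc m)

swap : ∀ {k} → Fin k → Fin k → Fin k → Fin k
swap a b x with x ≟ a
... | yes _ = b
... | no _ with x ≟ b
...   | yes _ = a
...   | no _ = x

data Move {k : ℕ} (L L' : Square k) : Set where
  rows : (a b : Fin k) → (∀ i j → L' i j ≡ L (swap a b i) j) → Move L L'
  cols : (a b : Fin k) → (∀ i j → L' i j ≡ L i (swap a b j)) → Move L L'
  syms : (a b : Fin k) → (∀ i j → L' i j ≡ swap a b (L i j)) → Move L L'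

data _∼_ {k : ℕ} : Square k → Square k → Set where
  done : ∀ {L L'} → (∀ i j → L i j ≡ L' i j) → L ∼ L'
  step : ∀ {L L' L''} → Move L L' → L' ∼ L'' → L ∼ L''

InG : ∀ {k} → Square k → Set
InG {k} L = IsLatin L × Σ (Square k) λ H → InG' H × L ∼ H

-- A transversal: row i ↦ cell (i , t i); no two cells in the same column
-- (t injective) and pairwise distinct entries.
IsTransversal : ∀ {k} → Square k → (Fin k → Fin k) → Set
IsTransversal {k} L t = Injective _≡_ _≡_ t × Injective _≡_ _≡_ (λ i → L i (t i))

HasTransversal : ∀ {k} → Square k → Set
HasTransversal {k} L = Σ (Fin k → Fin k) λ t → IsTransversal L t

HasKDisjointTransversals : ∀ {k} → Square k → Set
HasKDisjointTransversals {k} L =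
  Σ (Fin k → Fin k → Fin k) λ T →
    (∀ a → IsTransversal L (T a)) ×
    (∀ a b → ¬ a ≡ b → ∀ i → ¬ T a i ≡ T b i)

Orthogonal : ∀ {k} → Square k → Square k → Set
Orthogonal {k} L L' =
  Bijective {A = Fin k × Fin k} {B = Fin k × Fin k} _≡_ _≡_
    (λ { (i , j) → (L i j , L' i j) })

{-# OPTIONS --safe #-}
module Submission where

-- Let x be the point whose σ-orbit m ↦ σ^m x (m < k) exhausts Fin k. Since
-- σ is injective, σ^k x = x, so σ acts on the orbit as m ↦ m + 1 in ℤ/k; as σ
-- maps each row of L_σ to the next, L_σ i p = σ^(i + τ p) x, where τ p is the
-- position of L_σ 0 p on the orbit. Hence every square of 𝒢_k has the Cayley
-- form L i j = s (ρ i + γ j) for permutations ρ, γ, s, i.e. it is isotopic to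
-- the addition table of ℤ/k, which gives (1) as permutations are products of
-- transpositions. In Cayley form a transversal t yields the disjoint
-- transversals i ↦ γ⁻¹ (γ (t i) + a), one for each a (2), and for odd k the
-- square ρ i + 2 γ j is an orthogonal mate (3). For even k a mate would give a
-- transversal, i.e. permutations f, g of ℤ/k with f + g a permutation; summing
-- all values gives S + S = S for S = Σ a ≡ k/2 ≢ 0 (mod k), which is absurd (4).

open import Defs
open import Data.Nat using (ℕ; _≤_)
open import Data.Nat.Divisibility using (_∣_)
open import Data.Fin using (Fin)
open import Data.Product using (Σ; _×_)
open import Relation.Nullary using (¬_)
open import Function.Bundles using (_⇔_)

open import Level using (0ℓ)
open import Algebra.Bundles using (AbelianGroup)
open import Algebra.Structures using (IsAbelianGroup)
import Algebra.Properties.AbelianGroup as AbelianGroupProperties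
import Algebra.Properties.CommutativeMonoid.Sum as Sum
open import Data.Nat as ℕ using (zero; suc; s≤s; _+_; _*_; _∸_; _%_; _/_)
import Data.Nat.Properties as ℕ
open import Data.Nat.DivMod
  using (_mod_; %-distribˡ-+; %-distribˡ-*; n%n≡0; m%n%n≡m%n; m<n⇒m%n≡m; m%n<n; m≡m%n+[m/n]*n; [m+kn]%n≡m%n; m*n%n≡0)
open import Data.Nat.Divisibility using (divides; m%n≡0⇒n∣m)
open import Data.Nat.Tactic.RingSolver using (solve-∀)
open import Data.Fin as Fin using (toℕ; _≟_; punchOut)
import Data.Fin.Properties as Fin
open import Data.Fin.Induction using (<-weakInduction)
open import Data.Fin.Relation.Unary.Top using (view; ‵fromℕ; ‵inject₁)
open import Data.Fin.Permutation using (Permutation′; permutation; _⟨$⟩ʳ_; _⟨$⟩ˡ_; inverseʳ)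
import Data.Fin.Permutation.Components as PC
open import Data.Fin.Permutation.Transposition.List using (TranspositionList; eval; decompose; eval-decompose)
open import Data.List using ([]; _∷_)
open import Data.Product using (∃; _,_; proj₁; proj₂; map₁; map₂; uncurry)
open import Function using (id; _∘_; _↔_; Inverse; Injection)
open import Function.Bundles using (mk⇔)
open import Function.Definitions using (Injective; StrictlySurjective; Bijective)
open import Function.Consequences.Propositional using (strictlySurjective⇒surjective)
open import Function.Properties.Inverse using (↔⇒↣; ↔-sym)
open import Relation.Nullary using (yes; no; contradiction)
open import Relation.Binary.PropositionalEquality
open import Relation.Binary.PropositionalEquality.Algebra using (isMagma)

-- Injective endomaps of finite sets

Fin-injective⇒strictlySurjective : ∀ {n} {f : Fin n → Fin n} → Injective _≡_ _≡_ f → StrictlySurjective _≡_ f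
Fin-injective⇒strictlySurjective {suc n} {f} f-injective y with Fin.any? (λ x → f x ≟ y)
... | yes hit = hit
... | no miss = contradiction (Fin.injective⇒≤ missing-injective) ℕ.1+n≰n
  where
  y≢f : ∀ x → y ≢ f x
  y≢f x y≡fx = miss (x , sym y≡fx)
  missing-injective : Injective _≡_ _≡_ (λ x → punchOut (y≢f x))
  missing-injective = f-injective ∘ Fin.punchOut-injective (y≢f _) (y≢f _)

injective⇒permutation : ∀ {n} (f : Fin n → Fin n) → Injective _≡_ _≡_ f → Permutation′ n
injective⇒permutation f f-injective =
  permutation f (proj₁ ∘ onto) (proj₂ ∘ onto) (λ x → f-injective (proj₂ (onto (f x))))
  where
  onto : StrictlySurjective _≡_ f
  onto = Fin-injective⇒strictlySurjective f-injective

injective⇒bijective : ∀ {A : Set} {n} → A ↔ Fin n → {f : A → A} → Injective _≡_ _≡_ f → Bijective _≡_ _≡_ f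
injective⇒bijective A↔Fin {f} f-injective = f-injective , strictlySurjective⇒surjective onto
  where
  open Inverse A↔Fin
  conjugate-injective : Injective _≡_ _≡_ (to ∘ f ∘ from)
  conjugate-injective = Injection.injective (↔⇒↣ (↔-sym A↔Fin)) ∘ f-injective ∘ Injection.injective (↔⇒↣ A↔Fin)
  onto : StrictlySurjective _≡_ f
  onto y with Fin-injective⇒strictlySurjective conjugate-injective (to y)
  ... | x , to[f[x]]≡to[y] = from x , Injection.injective (↔⇒↣ A↔Fin) to[f[x]]≡to[y]

-- Moves and isotopy

swap≗transpose : ∀ {k} (a b x : Fin k) → swap a b x ≡ PC.transpose a b x
swap≗transpose a b x with x ≟ a
... | yes _ = refl
... | no _ with x ≟ b
...   | yes _ = refl
...   | no _ = refl

swap-inverse : ∀ {k} (a b x : Fin k) → swap a b (swap b a x) ≡ x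
swap-inverse a b x = begin
  swap a b (swap b a x)                 ≡⟨ swap≗transpose a b (swap b a x) ⟩
  PC.transpose a b (swap b a x)         ≡⟨ cong (PC.transpose a b) (swap≗transpose b a x) ⟩
  PC.transpose a b (PC.transpose b a x) ≡⟨ PC.transpose-inverse a b ⟩
  x                                     ∎
  where open ≡-Reasoning

swap-injective : ∀ {k} (a b : Fin k) → Injective _≡_ _≡_ (swap a b)
swap-injective a b {x} {y} eq = trans (sym (swap-inverse b a x)) (trans (cong (swap b a) eq) (swap-inverse b a y))

module _ {k : ℕ} where

  ∼-refl : {L : Square k} → L ∼ L
  ∼-refl = done (λ _ _ → refl)

  move-respˡ : {L L' M : Square k} → (∀ i j → L i j ≡ L' i j) → Move L' M → Move L M
  move-respˡ L≐L' (rows a b eq) = rows a b (λ i j → trans (eq i j) (sym (L≐L' _ j)))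
  move-respˡ L≐L' (cols a b eq) = cols a b (λ i j → trans (eq i j) (sym (L≐L' i _)))
  move-respˡ L≐L' (syms a b eq) = syms a b (λ i j → trans (eq i j) (cong (swap a b) (sym (L≐L' i j))))

  ∼-trans : {L M N : Square k} → L ∼ M → M ∼ N → L ∼ N
  ∼-trans (done L≐M) (done M≐N) = done (λ i j → trans (L≐M i j) (M≐N i j))
  ∼-trans (done L≐M) (step m M'∼N) = step (move-respˡ L≐M m) M'∼N
  ∼-trans (step m L'∼M) M∼N = step m (∼-trans L'∼M M∼N)

  move-sym : {L M : Square k} → Move L M → Move M L
  move-sym {L} (rows a b eq) = rows b a (λ i j → trans (cong (λ r → L r j) (sym (swap-inverse a b i))) (sym (eq _ j)))
  move-sym {L} (cols a b eq) = cols b a (λ i j → trans (cong (L i) (sym (swap-inverse a b j))) (sym (eq i _)))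
  move-sym {L} (syms a b eq) = syms b a (λ i j → trans (sym (swap-inverse b a (L i j))) (cong (swap b a) (sym (eq i j))))

  ∼-sym : {L M : Square k} → L ∼ M → M ∼ L
  ∼-sym (done L≐M) = done (λ i j → sym (L≐M i j))
  ∼-sym (step m L'∼M) = ∼-trans (∼-sym L'∼M) (step (move-sym m) ∼-refl)

  ∼-isotope : ∀ {ρ γ s : Fin k → Fin k} →
              Injective _≡_ _≡_ ρ → Injective _≡_ _≡_ γ → Injective _≡_ _≡_ s →
              ∀ L → L ∼ (λ i j → s (L (ρ i) (γ j)))
  ∼-isotope {ρ} {γ} {s} ρ-injective γ-injective s-injective L =
    ∼-trans (permuteRows (decompose ρₚ) L)
    (∼-trans (permuteCols (decompose γₚ) _)
    (∼-trans (permuteSyms (decompose sₚ) _)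
    (done (λ i j → trans (eval-decompose sₚ _)
                         (cong s (cong₂ L (eval-decompose ρₚ i) (eval-decompose γₚ j)))))))
    where
    ρₚ γₚ sₚ : Permutation′ k
    ρₚ = injective⇒permutation ρ ρ-injective
    γₚ = injective⇒permutation γ γ-injective
    sₚ = injective⇒permutation s s-injective

    permuteRows : ∀ (xs : TranspositionList k) L → L ∼ (λ i j → L (eval xs ⟨$⟩ʳ i) j)
    permuteRows []             L = ∼-refl
    permuteRows ((a , b) ∷ xs) L = ∼-trans (permuteRows xs L)
      (step (rows a b (λ i j → cong (λ r → L (eval xs ⟨$⟩ʳ r) j) (sym (swap≗transpose a b i)))) ∼-refl)

    permuteCols : ∀ (xs : TranspositionList k) L → L ∼ (λ i j → L i (eval xs ⟨$⟩ʳ j))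
    permuteCols []             L = ∼-refl
    permuteCols ((a , b) ∷ xs) L = ∼-trans (permuteCols xs L)
      (step (cols a b (λ i j → cong (λ c → L i (eval xs ⟨$⟩ʳ c)) (sym (swap≗transpose a b j)))) ∼-refl)

    permuteSyms : ∀ (xs : TranspositionList k) L → L ∼ (λ i j → eval xs ⟨$⟩ʳ (L i j))
    permuteSyms []             L = ∼-refl
    permuteSyms ((a , b) ∷ xs) L =
      step (syms a b (λ i j → sym (swap≗transpose a b (L i j)))) (permuteSyms xs _)

-- The cyclic group ℤ/k on Fin k

module _ {n : ℕ} where

  private
    K : ℕ
    K = suc n

  infixl 6 _⊕_

  _⊕_ : Fin K → Fin K → Fin K
  a ⊕ b = (toℕ a + toℕ b) mod K

  ⊖_ : Fin K → Fin K
  ⊖ a = (K ∸ toℕ a) mod K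

  toℕ-mod : ∀ x → toℕ (x mod K) ≡ x % K
  toℕ-mod x = Fin.toℕ-fromℕ< _

  mod-cong : ∀ x y → x % K ≡ y % K → x mod K ≡ y mod K
  mod-cong x y eq = Fin.toℕ-injective (trans (toℕ-mod x) (trans eq (sym (toℕ-mod y))))

  mod-toℕ : ∀ a → toℕ a mod K ≡ a
  mod-toℕ a = Fin.toℕ-injective (trans (toℕ-mod (toℕ a)) (m<n⇒m%n≡m (Fin.toℕ<n a)))

  mod-+ : ∀ x y → (x + y) mod K ≡ x mod K ⊕ y mod K
  mod-+ x y = mod-cong (x + y) (toℕ (x mod K) + toℕ (y mod K)) (trans (%-distribˡ-+ x y K)
    (sym (cong₂ (λ u v → (u + v) % K) (toℕ-mod x) (toℕ-mod y))))

  mod-*ˡ : ∀ x y → (toℕ (x mod K) * y) mod K ≡ (x * y) mod K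
  mod-*ˡ x y = mod-cong (toℕ (x mod K) * y) (x * y) (begin
    (toℕ (x mod K) * y) % K  ≡⟨ cong (λ m → (m * y) % K) (toℕ-mod x) ⟩
    (x % K * y) % K          ≡⟨ %-distribˡ-* (x % K) y K ⟩
    (x % K % K * (y % K)) % K ≡⟨ cong (λ m → (m * (y % K)) % K) (m%n%n≡m%n x K) ⟩
    (x % K * (y % K)) % K    ≡⟨ %-distribˡ-* x y K ⟨
    (x * y) % K              ∎)
    where open ≡-Reasoning

  ⊕-comm : ∀ a b → a ⊕ b ≡ b ⊕ a
  ⊕-comm a b = cong (_mod K) (ℕ.+-comm (toℕ a) (toℕ b))

  ⊕-assoc : ∀ a b c → (a ⊕ b) ⊕ c ≡ a ⊕ (b ⊕ c)
  ⊕-assoc a b c = begin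
    (a ⊕ b) ⊕ c                            ≡⟨ cong ((a ⊕ b) ⊕_) (mod-toℕ c) ⟨
    (a ⊕ b) ⊕ toℕ c mod K                  ≡⟨ mod-+ (toℕ a + toℕ b) (toℕ c) ⟨
    (toℕ a + toℕ b + toℕ c) mod K          ≡⟨ cong (_mod K) (ℕ.+-assoc (toℕ a) (toℕ b) (toℕ c)) ⟩
    (toℕ a + (toℕ b + toℕ c)) mod K        ≡⟨ mod-+ (toℕ a) (toℕ b + toℕ c) ⟩
    toℕ a mod K ⊕ (b ⊕ c)                  ≡⟨ cong (_⊕ (b ⊕ c)) (mod-toℕ a) ⟩
    a ⊕ (b ⊕ c)                            ∎
    where open ≡-Reasoning

  ⊕-identityˡ : ∀ a → Fin.zero ⊕ a ≡ a
  ⊕-identityˡ = mod-toℕ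

  ⊕-identityʳ : ∀ a → a ⊕ Fin.zero ≡ a
  ⊕-identityʳ a = trans (⊕-comm a Fin.zero) (⊕-identityˡ a)

  ⊖-inverseʳ : ∀ a → a ⊕ ⊖ a ≡ Fin.zero
  ⊖-inverseʳ a = begin
    a ⊕ ⊖ a                     ≡⟨ cong (_⊕ ⊖ a) (mod-toℕ a) ⟨
    toℕ a mod K ⊕ ⊖ a           ≡⟨ mod-+ (toℕ a) (K ∸ toℕ a) ⟨
    (toℕ a + (K ∸ toℕ a)) mod K ≡⟨ cong (_mod K) (ℕ.m+[n∸m]≡n (ℕ.<⇒≤ (Fin.toℕ<n a))) ⟩
    K mod K                     ≡⟨ mod-cong K 0 (n%n≡0 K) ⟩
    Fin.zero                    ∎
    where open ≡-Reasoning

  ⊖-inverseˡ : ∀ a → ⊖ a ⊕ a ≡ Fin.zero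
  ⊖-inverseˡ a = trans (⊕-comm (⊖ a) a) (⊖-inverseʳ a)

  ⊕-isAbelianGroup : IsAbelianGroup _≡_ _⊕_ Fin.zero ⊖_
  ⊕-isAbelianGroup = record
    { isGroup = record
      { isMonoid = record
        { isSemigroup = record { isMagma = isMagma _⊕_ ; assoc = ⊕-assoc }
        ; identity    = ⊕-identityˡ , ⊕-identityʳ
        }
      ; inverse = ⊖-inverseˡ , ⊖-inverseʳ
      ; ⁻¹-cong = cong ⊖_
      }
    ; comm = ⊕-comm
    }

cyclicGroup : ℕ → AbelianGroup 0ℓ 0ℓ
cyclicGroup n = record { isAbelianGroup = ⊕-isAbelianGroup {n} }

module _ {n : ℕ} where

  private
    K : ℕ
    K = suc n

  open AbelianGroupProperties (cyclicGroup n) using (∙-cancelˡ; ∙-cancelʳ)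

  ⊕-cancelˡ : ∀ a {b c : Fin K} → a ⊕ b ≡ a ⊕ c → b ≡ c
  ⊕-cancelˡ a = ∙-cancelˡ a _ _

  ⊕-cancelʳ : ∀ a {b c : Fin K} → b ⊕ a ≡ c ⊕ a → b ≡ c
  ⊕-cancelʳ a = ∙-cancelʳ a _ _

  cyc≡1⊕ : ∀ a → cyc K a ≡ 1 mod K ⊕ a
  cyc≡1⊕ a = trans (mod-+ 1 (toℕ a)) (cong (1 mod K ⊕_) (mod-toℕ a))

  cyc-⊕ : ∀ a b → cyc K (a ⊕ b) ≡ cyc K a ⊕ b
  cyc-⊕ a b = begin
    cyc K (a ⊕ b)       ≡⟨ cyc≡1⊕ (a ⊕ b) ⟩
    1 mod K ⊕ (a ⊕ b)   ≡⟨ ⊕-assoc (1 mod K) a b ⟨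
    (1 mod K ⊕ a) ⊕ b   ≡⟨ cong (_⊕ b) (cyc≡1⊕ a) ⟨
    cyc K a ⊕ b         ∎
    where open ≡-Reasoning

  cyc-adjacent : ∀ {i j : Fin K} → toℕ j ≡ suc (toℕ i) → cyc K i ≡ j
  cyc-adjacent {j = j} j≡1+i = trans (cong (_mod K) (sym j≡1+i)) (mod-toℕ j)

  cyc-shift : ∀ {i j : Fin K} → toℕ j ≡ suc (toℕ i) → ∀ p → cyc K (i ⊕ p) ≡ j ⊕ p
  cyc-shift j≡1+i p = trans (cyc-⊕ _ p) (cong (_⊕ p) (cyc-adjacent j≡1+i))

  cyc-last : cyc K (Fin.fromℕ n) ≡ Fin.zero
  cyc-last = trans (cong (λ m → suc m mod K) (Fin.toℕ-fromℕ n)) (mod-cong K 0 (n%n≡0 K))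

  iter-cyc : ∀ m → iter (cyc K) m Fin.zero ≡ m mod K
  iter-cyc zero    = refl
  iter-cyc (suc m) = trans (cyc≡1⊕ _) (trans (cong (1 mod K ⊕_) (iter-cyc m)) (sym (mod-+ 1 m)))

  cyc-isKCycle : IsKCycle (cyc K)
  cyc-isKCycle = Fin.zero , λ {a} {b} eq → trans (sym (orbit a)) (trans eq (orbit b))
    where
    orbit : ∀ a → iter (cyc K) (toℕ a) Fin.zero ≡ a
    orbit a = trans (iter-cyc (toℕ a)) (mod-toℕ a)

  cayley : Square K
  cayley i j = i ⊕ j

  cayley-Lσ : IsLσ cayley (cyc K)
  cayley-Lσ = (⊕-cancelˡ , ⊕-cancelʳ)
            , (λ i j j≡1+i → cyc-shift j≡1+i)
            , cyc-isKCycle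

-- Squares in Cayley form

record CayleyForm {n} (L : Square (suc n)) : Set where
  field
    row col symbol   : Fin (suc n) → Fin (suc n)
    row-injective    : Injective _≡_ _≡_ row
    col-injective    : Injective _≡_ _≡_ col
    symbol-injective : Injective _≡_ _≡_ symbol
    table            : ∀ i j → L i j ≡ symbol (row i ⊕ col j)

  entry-injective : ∀ {i j i' j'} → L i j ≡ L i' j' → row i ⊕ col j ≡ row i' ⊕ col j'
  entry-injective eq = symbol-injective (trans (sym (table _ _)) (trans eq (table _ _)))

  entry-cong : ∀ {i j i' j'} → row i ⊕ col j ≡ row i' ⊕ col j' → L i j ≡ L i' j'
  entry-cong eq = trans (table _ _) (trans (cong symbol eq) (sym (table _ _)))

  latin : IsLatin L
  latin = (λ i → col-injective ∘ ⊕-cancelˡ (row i) ∘ entry-injective)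
        , (λ j → row-injective ∘ ⊕-cancelʳ (col j) ∘ entry-injective)

module _ {n : ℕ} where

  private
    K : ℕ
    K = suc n

  cayleyForm-isotope : ∀ {L M : Square K} {ρ γ s : Fin K → Fin K} →
                       Injective _≡_ _≡_ ρ → Injective _≡_ _≡_ γ → Injective _≡_ _≡_ s →
                       (∀ i j → M i j ≡ s (L (ρ i) (γ j))) → CayleyForm L → CayleyForm M
  cayleyForm-isotope {ρ = ρ} {γ} {s} ρ-injective γ-injective s-injective M≐sLργ cf = record
    { row              = row ∘ ρ
    ; col              = col ∘ γ
    ; symbol           = s ∘ symbol
    ; row-injective    = ρ-injective ∘ row-injective
    ; col-injective    = γ-injective ∘ col-injective
    ; symbol-injective = symbol-injective ∘ s-injective
    ; table            = λ i j → trans (M≐sLργ i j) (cong s (table (ρ i) (γ j)))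
    }
    where open CayleyForm cf

  cayleyForm-move : {L L' : Square K} → Move L L' → CayleyForm L' → CayleyForm L
  cayleyForm-move {L} (rows a b eq) = cayleyForm-isotope (swap-injective b a) id id
    (λ i j → trans (cong (λ r → L r j) (sym (swap-inverse a b i))) (sym (eq _ j)))
  cayleyForm-move {L} (cols a b eq) = cayleyForm-isotope id (swap-injective b a) id
    (λ i j → trans (cong (L i) (sym (swap-inverse a b j))) (sym (eq i _)))
  cayleyForm-move {L} (syms a b eq) = cayleyForm-isotope id id (swap-injective b a)
    (λ i j → trans (sym (swap-inverse b a (L i j))) (cong (swap b a) (sym (eq i j))))

  cayleyForm-pullback : {L H : Square K} → L ∼ H → CayleyForm H → CayleyForm L
  cayleyForm-pullback (done L≐H)    = cayleyForm-isotope id id id L≐H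
  cayleyForm-pullback (step m L'∼H) = cayleyForm-move m ∘ cayleyForm-pullback L'∼H

  cayley-∼ : {L : Square K} → CayleyForm L → cayley ∼ L
  cayley-∼ cf = ∼-trans (∼-isotope row-injective col-injective symbol-injective cayley)
                        (done (λ i j → sym (table i j)))
    where open CayleyForm cf

  cayleyForms-∼ : {L M : Square K} → CayleyForm L → CayleyForm M → L ∼ M
  cayleyForms-∼ cfL cfM = ∼-trans (∼-sym (cayley-∼ cfL)) (cayley-∼ cfM)

  cayleyForm⇒InG : {L : Square K} → CayleyForm L → InG L
  cayleyForm⇒InG cf = CayleyForm.latin cf , cayley , (cyc K , cayley-Lσ) , ∼-sym (cayley-∼ cf)

Lσ⇒σ-injective : ∀ {n} {L : Square (suc n)} {σ} → IsLσ L σ → Injective _≡_ _≡_ σ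
Lσ⇒σ-injective {zero}  _ {Fin.zero} {Fin.zero} _ = refl
Lσ⇒σ-injective {suc n} {L} {σ} ((row-injective , _) , adjacent , _) {a} {b} σa≡σb
  with Fin-injective⇒strictlySurjective (row-injective Fin.zero) a
     | Fin-injective⇒strictlySurjective (row-injective Fin.zero) b
... | p , refl | q , refl = cong (L Fin.zero) (row-injective (Fin.suc Fin.zero) (begin
  L (Fin.suc Fin.zero) p  ≡⟨ adjacent Fin.zero (Fin.suc Fin.zero) refl p ⟨
  σ (L Fin.zero p)        ≡⟨ σa≡σb ⟩
  σ (L Fin.zero q)        ≡⟨ adjacent Fin.zero (Fin.suc Fin.zero) refl q ⟩
  L (Fin.suc Fin.zero) q  ∎))
  where open ≡-Reasoning

module _ {n} {L : Square (suc n)} {σ} (Lσ : IsLσ L σ) where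

  private
    K : ℕ
    K = suc n

    row-injective : ∀ i → Injective _≡_ _≡_ (L i)
    row-injective = proj₁ (proj₁ Lσ)

    adjacent : ∀ i j → toℕ j ≡ suc (toℕ i) → IsSigma L i j σ
    adjacent = proj₁ (proj₂ Lσ)

    x : Fin K
    x = proj₁ (proj₂ (proj₂ Lσ))

    orbit : Fin K → Fin K
    orbit m = iter σ (toℕ m) x

    orbit-injective : Injective _≡_ _≡_ orbit
    orbit-injective = proj₂ (proj₂ (proj₂ Lσ))

    orbit-suc : ∀ m → orbit (Fin.suc m) ≡ σ (orbit (Fin.inject₁ m))
    orbit-suc m = cong (λ t → σ (iter σ t x)) (sym (Fin.toℕ-inject₁ m))

    -- σ^K x lies on the orbit, and injectivity of σ rules out every position but 0.
    orbit-closes : σ (orbit (Fin.fromℕ n)) ≡ x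
    orbit-closes with Fin-injective⇒strictlySurjective orbit-injective (σ (orbit (Fin.fromℕ n)))
    ... | Fin.zero  , x≡σ[last] = sym x≡σ[last]
    ... | Fin.suc m , orbit[1+m]≡σ[last] = contradiction
      (orbit-injective {Fin.inject₁ m} (Lσ⇒σ-injective Lσ (trans (sym (orbit-suc m)) orbit[1+m]≡σ[last])))
      (Fin.fromℕ≢inject₁ ∘ sym)

    σ-rotates-orbit : ∀ m → σ (orbit m) ≡ orbit (cyc K m)
    σ-rotates-orbit m with view m
    ... | ‵fromℕ      = trans orbit-closes (cong orbit (sym cyc-last))
    ... | ‵inject₁ m' = trans (sym (orbit-suc m')) (cong orbit (sym (cyc-adjacent (cong suc (sym (Fin.toℕ-inject₁ m'))))))

    label : Fin K → Fin K
    label p = proj₁ (Fin-injective⇒strictlySurjective orbit-injective (L Fin.zero p))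

    orbit-label : ∀ p → orbit (label p) ≡ L Fin.zero p
    orbit-label p = proj₂ (Fin-injective⇒strictlySurjective orbit-injective (L Fin.zero p))

    label-injective : Injective _≡_ _≡_ label
    label-injective {p} {q} eq = row-injective Fin.zero (trans (sym (orbit-label p)) (trans (cong orbit eq) (orbit-label q)))

    table : ∀ i p → L i p ≡ orbit (i ⊕ label p)
    table = <-weakInduction (λ i → ∀ p → L i p ≡ orbit (i ⊕ label p)) first next
      where
      first : ∀ p → L Fin.zero p ≡ orbit (Fin.zero ⊕ label p)
      first p = trans (sym (orbit-label p)) (cong orbit (sym (⊕-identityˡ (label p))))
      next : ∀ i → (∀ p → L (Fin.inject₁ i) p ≡ orbit (Fin.inject₁ i ⊕ label p)) →
                   ∀ p → L (Fin.suc i) p ≡ orbit (Fin.suc i ⊕ label p)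
      next i table-i p = begin
        L (Fin.suc i) p                        ≡⟨ adjacent _ _ i+1≡1+i p ⟨
        σ (L (Fin.inject₁ i) p)                ≡⟨ cong σ (table-i p) ⟩
        σ (orbit (Fin.inject₁ i ⊕ label p))    ≡⟨ σ-rotates-orbit _ ⟩
        orbit (cyc K (Fin.inject₁ i ⊕ label p)) ≡⟨ cong orbit (cyc-shift i+1≡1+i (label p)) ⟩
        orbit (Fin.suc i ⊕ label p)            ∎
        where
        open ≡-Reasoning
        i+1≡1+i : toℕ (Fin.suc i) ≡ suc (toℕ (Fin.inject₁ i))
        i+1≡1+i = cong suc (sym (Fin.toℕ-inject₁ i))

  Lσ⇒cayleyForm : CayleyForm L
  Lσ⇒cayleyForm = record
    { row              = id
    ; col              = label
    ; symbol           = orbit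
    ; row-injective    = id
    ; col-injective    = label-injective
    ; symbol-injective = orbit-injective
    ; table            = table
    }

InG⇒cayleyForm : ∀ {n} {L : Square (suc n)} → InG L → CayleyForm L
InG⇒cayleyForm (_ , H , (σ , Hσ) , L∼H) = cayleyForm-pullback L∼H (Lσ⇒cayleyForm Hσ)

-- Transversals and orthogonal mates

module _ {n} {L : Square (suc n)} (cf : CayleyForm L) where

  open CayleyForm cf

  cayleyForm-disjointTransversals : HasTransversal L → HasKDisjointTransversals L
  cayleyForm-disjointTransversals (t , t-injective , t-entries-injective) =
    shifted , (λ a → shifted-injective a , shifted-entries-injective a) , shifted-disjoint
    where
    colₚ : Permutation′ (suc n)
    colₚ = injective⇒permutation col col-injective

    shifted : Fin (suc n) → Fin (suc n) → Fin (suc n)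
    shifted a i = colₚ ⟨$⟩ˡ (col (t i) ⊕ a)

    col-shifted : ∀ a i → col (shifted a i) ≡ col (t i) ⊕ a
    col-shifted a i = inverseʳ colₚ

    shifted-injective : ∀ a → Injective _≡_ _≡_ (shifted a)
    shifted-injective a {i} {j} eq = t-injective (col-injective (⊕-cancelʳ a (begin
      col (t i) ⊕ a     ≡⟨ col-shifted a i ⟨
      col (shifted a i) ≡⟨ cong col eq ⟩
      col (shifted a j) ≡⟨ col-shifted a j ⟩
      col (t j) ⊕ a     ∎)))
      where open ≡-Reasoning

    entry-shifted : ∀ a i → row i ⊕ col (shifted a i) ≡ (row i ⊕ col (t i)) ⊕ a
    entry-shifted a i = trans (cong (row i ⊕_) (col-shifted a i)) (sym (⊕-assoc (row i) (col (t i)) a))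

    shifted-entries-injective : ∀ a → Injective _≡_ _≡_ (λ i → L i (shifted a i))
    shifted-entries-injective a {i} {j} eq = t-entries-injective (entry-cong (⊕-cancelʳ a (begin
      (row i ⊕ col (t i)) ⊕ a   ≡⟨ entry-shifted a i ⟨
      row i ⊕ col (shifted a i) ≡⟨ entry-injective eq ⟩
      row j ⊕ col (shifted a j) ≡⟨ entry-shifted a j ⟩
      (row j ⊕ col (t j)) ⊕ a   ∎)))
      where open ≡-Reasoning

    shifted-disjoint : ∀ a b → a ≢ b → ∀ i → shifted a i ≢ shifted b i
    shifted-disjoint a b a≢b i eq = a≢b (⊕-cancelˡ (col (t i))
      (trans (sym (col-shifted a i)) (trans (cong col eq) (col-shifted b i))))

pairs-injective⇒orthogonal : ∀ {k} {L M : Square k} →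
             (∀ {i j i' j'} → L i j ≡ L i' j' → M i j ≡ M i' j' → i ≡ i' × j ≡ j') → Orthogonal L M
pairs-injective⇒orthogonal same-cell = injective⇒bijective (↔-sym Fin.*↔×)
  λ { {i , j} {i' , j'} eq → uncurry (cong₂ _,_) (same-cell (cong proj₁ eq) (cong proj₂ eq)) }

odd⇒m≡1+[m/2]*2 : ∀ {m} → ¬ 2 ∣ m → m ≡ 1 + (m / 2) * 2
odd⇒m≡1+[m/2]*2 {m} 2∤m with m % 2 | m≡m%n+[m/n]*n m 2 | m%n<n m 2 | m%n≡0⇒n∣m m 2
... | 0           | _           | _            | 2∣m = contradiction (2∣m refl) 2∤m
... | 1           | m≡1+[m/2]*2 | _            | _   = m≡1+[m/2]*2
... | suc (suc _) | _           | s≤s (s≤s ()) | _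

module _ {n} (2∤K : ¬ 2 ∣ suc n) where

  private
    K h : ℕ
    K = suc n
    h = K / 2

  double-injective : Injective _≡_ _≡_ (λ (a : Fin K) → a ⊕ a)
  double-injective {a} {b} eq = trans (sym (halve-double a)) (trans (cong halve eq) (halve-double b))
    where
    -- 1 + h = (K + 1) / 2 inverts 2 modulo K = 1 + 2h.
    halve : Fin K → Fin K
    halve a = (toℕ a * suc h) mod K

    halve-double : ∀ a → halve (a ⊕ a) ≡ a
    halve-double a = begin
      (toℕ (a ⊕ a) * suc h) mod K       ≡⟨ mod-*ˡ (toℕ a + toℕ a) (suc h) ⟩
      ((toℕ a + toℕ a) * suc h) mod K   ≡⟨ cong (_mod K) ([a+a]*[1+h]≡a+a*[1+2h] (toℕ a) h) ⟩
      (toℕ a + toℕ a * (1 + h * 2)) mod K ≡⟨ cong (λ m → (toℕ a + toℕ a * m) mod K) (odd⇒m≡1+[m/2]*2 2∤K) ⟨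
      (toℕ a + toℕ a * K) mod K         ≡⟨ mod-cong (toℕ a + toℕ a * K) (toℕ a) ([m+kn]%n≡m%n (toℕ a) (toℕ a) K) ⟩
      toℕ a mod K                       ≡⟨ mod-toℕ a ⟩
      a                                 ∎
      where
      open ≡-Reasoning
      [a+a]*[1+h]≡a+a*[1+2h] : ∀ a h → (a + a) * suc h ≡ a + a * (1 + h * 2)
      [a+a]*[1+h]≡a+a*[1+2h] = solve-∀

module _ {n} {L : Square (suc n)} where

  cayleyForm-orthogonalMate : ¬ 2 ∣ suc n → CayleyForm L → Σ (Square (suc n)) λ M → CayleyForm M × Orthogonal L M
  cayleyForm-orthogonalMate 2∤K cf = M , cayleyForm-M , pairs-injective⇒orthogonal same-cell
    where
    open CayleyForm cf
    M : Square (suc n)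
    M i j = row i ⊕ (col j ⊕ col j)

    cayleyForm-M : CayleyForm M
    cayleyForm-M = record
      { row              = row
      ; col              = λ j → col j ⊕ col j
      ; symbol           = id
      ; row-injective    = row-injective
      ; col-injective    = col-injective ∘ double-injective 2∤K
      ; symbol-injective = id
      ; table            = λ _ _ → refl
      }

    same-cell : ∀ {i j i' j'} → L i j ≡ L i' j' → M i j ≡ M i' j' → i ≡ i' × j ≡ j'
    same-cell {i} {j} {i'} {j'} L≡ M≡ = row-injective (⊕-cancelʳ (col j) (trans sum≡ (cong (row i' ⊕_) (sym col≡)))) , col-injective col≡
      where
      sum≡ : row i ⊕ col j ≡ row i' ⊕ col j'
      sum≡ = entry-injective L≡
      col≡ : col j ≡ col j'
      col≡ = ⊕-cancelˡ (row i' ⊕ col j') (begin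
        (row i' ⊕ col j') ⊕ col j ≡⟨ cong (_⊕ col j) sum≡ ⟨
        (row i ⊕ col j) ⊕ col j   ≡⟨ ⊕-assoc (row i) (col j) (col j) ⟩
        M i j                     ≡⟨ M≡ ⟩
        M i' j'                   ≡⟨ ⊕-assoc (row i') (col j') (col j') ⟨
        (row i' ⊕ col j') ⊕ col j' ∎)
        where open ≡-Reasoning

orthogonal⇒transversal : ∀ {n} {L L' : Square (suc n)} → IsLatin L' → Orthogonal L L' → HasTransversal L
orthogonal⇒transversal {n} {L} {L'} (L'-rows , L'-cols) (pairing-injective , _) =
  t , t-injective , entries-injective
  where
  zero-in-row : ∀ i → ∃ λ j → L' i j ≡ Fin.zero
  zero-in-row i = Fin-injective⇒strictlySurjective (L'-rows i) Fin.zero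

  t : Fin (suc n) → Fin (suc n)
  t i = proj₁ (zero-in-row i)

  L'[i,t[i]]≡0 : ∀ i → L' i (t i) ≡ Fin.zero
  L'[i,t[i]]≡0 i = proj₂ (zero-in-row i)

  t-injective : Injective _≡_ _≡_ t
  t-injective {i} {j} eq = L'-cols (t j) (trans (cong (L' i) (sym eq)) (trans (L'[i,t[i]]≡0 i) (sym (L'[i,t[i]]≡0 j))))

  entries-injective : Injective _≡_ _≡_ (λ i → L i (t i))
  entries-injective {i} {j} eq = cong proj₁ (pairing-injective {i , t i} {j , t j}
    (cong₂ _,_ eq (trans (L'[i,t[i]]≡0 i) (sym (L'[i,t[i]]≡0 j)))))

module ℕΣ = Sum ℕ.+-0-commutativeMonoid

sum-toℕ*2+m≡m*m : ∀ m → ℕΣ.sum {m} toℕ * 2 + m ≡ m * m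
sum-toℕ*2+m≡m*m zero    = refl
sum-toℕ*2+m≡m*m (suc m) = begin
  ℕΣ.sum {suc m} toℕ * 2 + suc m                  ≡⟨ cong (λ s → s * 2 + suc m) (ℕΣ.sum-init-last {m} toℕ) ⟩
  (ℕΣ.sum {m} (toℕ ∘ Fin.inject₁) + toℕ (Fin.fromℕ m)) * 2 + suc m
    ≡⟨ cong₂ (λ s l → (s + l) * 2 + suc m) (ℕΣ.sum-cong-≗ {m} Fin.toℕ-inject₁) (Fin.toℕ-fromℕ m) ⟩
  (ℕΣ.sum {m} toℕ + m) * 2 + suc m                ≡⟨ regroup (ℕΣ.sum {m} toℕ) m ⟩
  (ℕΣ.sum {m} toℕ * 2 + m) + (m + suc m)          ≡⟨ cong (_+ (m + suc m)) (sum-toℕ*2+m≡m*m m) ⟩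
  m * m + (m + suc m)                             ≡⟨ square-suc m ⟩
  suc m * suc m                                   ∎
  where
  open ≡-Reasoning
  regroup : ∀ s m → (s + m) * 2 + suc m ≡ (s * 2 + m) + (m + suc m)
  regroup = solve-∀
  square-suc : ∀ m → m * m + (m + suc m) ≡ suc m * suc m
  square-suc = solve-∀

module _ {n : ℕ} where

  private
    K : ℕ
    K = suc n

  open Sum (AbelianGroup.commutativeMonoid (cyclicGroup n)) using (sum-permute; sum-cong-≗; ∑-distrib-+)
    renaming (sum to ∑)

  ∑-mod : ∀ {m} (g : Fin m → ℕ) → ∑ (λ i → g i mod K) ≡ ℕΣ.sum g mod K
  ∑-mod {zero}  g = refl
  ∑-mod {suc m} g = trans (cong (g Fin.zero mod K ⊕_) (∑-mod (g ∘ Fin.suc))) (sym (mod-+ (g Fin.zero) _))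

  ∑-injective : ∀ {f : Fin K → Fin K} → Injective _≡_ _≡_ f → ∑ f ≡ ∑ id
  ∑-injective {f} f-injective = sym (sum-permute id (injective⇒permutation f f-injective))

  -- For K = 2q the elements sum to K(K − 1)/2 = q + (q − 1)K ≡ q.
  even⇒∑≢0 : 2 ∣ K → ∑ id ≢ Fin.zero
  even⇒∑≢0 (divides zero ())
  even⇒∑≢0 (divides (suc q) K≡[1+q]*2) ∑≡0 = ℕ.1+n≢0 (begin
    suc q           ≡⟨ m<n⇒m%n≡m q<K ⟨
    suc q % K       ≡⟨ toℕ-mod (suc q) ⟨
    toℕ (suc q mod K) ≡⟨ cong toℕ q≡0 ⟩
    0               ∎)
    where
    open ≡-Reasoning
    q<K : suc q ℕ.< K
    q<K = subst (suc q ℕ.<_) (sym K≡[1+q]*2) (ℕ.m<m*n (suc q) 2 (s≤s (s≤s ℕ.z≤n)))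
    T : ℕ
    T = ℕΣ.sum {K} toℕ
    T≡0 : T mod K ≡ Fin.zero
    T≡0 = trans (sym (∑-mod {K} toℕ)) (trans (sum-cong-≗ {K} mod-toℕ) ∑≡0)
    T+q≡q*K : T + suc q ≡ suc q * K
    T+q≡q*K = ℕ.*-cancelʳ-≡ (T + suc q) (suc q * K) 2 (begin
      (T + suc q) * 2     ≡⟨ ℕ.*-distribʳ-+ 2 T (suc q) ⟩
      T * 2 + suc q * 2   ≡⟨ cong (T * 2 +_) K≡[1+q]*2 ⟨
      T * 2 + K           ≡⟨ sum-toℕ*2+m≡m*m K ⟩
      K * K               ≡⟨ cong (K *_) K≡[1+q]*2 ⟩
      K * (suc q * 2)     ≡⟨ ℕ.*-assoc K (suc q) 2 ⟨
      K * suc q * 2       ≡⟨ cong (_* 2) (ℕ.*-comm K (suc q)) ⟩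
      suc q * K * 2       ∎)
    q≡0 : suc q mod K ≡ Fin.zero
    q≡0 = begin
      suc q mod K                ≡⟨ ⊕-identityˡ (suc q mod K) ⟨
      Fin.zero ⊕ suc q mod K     ≡⟨ cong (_⊕ suc q mod K) T≡0 ⟨
      T mod K ⊕ suc q mod K      ≡⟨ mod-+ T (suc q) ⟨
      (T + suc q) mod K          ≡⟨ cong (_mod K) T+q≡q*K ⟩
      (suc q * K) mod K          ≡⟨ mod-cong (suc q * K) 0 (m*n%n≡0 (suc q) K) ⟩
      Fin.zero                   ∎

  even⇒⊕-notInjective : 2 ∣ K → ∀ {f g : Fin K → Fin K} →
                        Injective _≡_ _≡_ f → Injective _≡_ _≡_ g → ¬ Injective _≡_ _≡_ (λ i → f i ⊕ g i)
  even⇒⊕-notInjective 2∣K {f} {g} f-injective g-injective f⊕g-injective = even⇒∑≢0 2∣K (⊕-cancelˡ (∑ id) (begin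
    ∑ id ⊕ ∑ id          ≡⟨ cong₂ _⊕_ (∑-injective f-injective) (∑-injective g-injective) ⟨
    ∑ f ⊕ ∑ g            ≡⟨ ∑-distrib-+ f g ⟨
    ∑ (λ i → f i ⊕ g i)  ≡⟨ ∑-injective f⊕g-injective ⟩
    ∑ id                 ≡⟨ ⊕-identityʳ (∑ id) ⟨
    ∑ id ⊕ Fin.zero      ∎))
    where open ≡-Reasoning

  cayleyForm-noTransversal : 2 ∣ K → {L : Square K} → CayleyForm L → ¬ HasTransversal L
  cayleyForm-noTransversal 2∣K cf (t , t-injective , entries-injective) =
    even⇒⊕-notInjective 2∣K row-injective (t-injective ∘ col-injective) (entries-injective ∘ entry-cong)
    where open CayleyForm cf

-- The hypothesis 3 ≤ k only serves to exclude k = 0.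
lemma3p1 : (k : ℕ) → 3 ≤ k →
    -- (1)
    ((∀ (L : Square k) (σ : Fin k → Fin k) (H : Square k) →
        IsLσ L σ → IsLσ H (cyc k) → L ∼ H) ×
     (Σ (Square k) InG × (∀ (L L' : Square k) → InG L → InG L' → L ∼ L'))) ×
    -- (2)
    (∀ (L : Square k) (σ : Fin k → Fin k) → IsLσ L σ →
        (HasTransversal L ⇔ HasKDisjointTransversals L)) ×
    -- (3)
    (¬ (2 ∣ k) → ∀ (L : Square k) → InG L →
        Σ (Square k) λ L' → InG L' × Orthogonal L L') ×
    -- (4)
    (2 ∣ k → ∀ (L : Square k) → InG L →
        ∀ (L' : Square k) → IsLatin L' → ¬ Orthogonal L L')
lemma3p1 (suc n) _ =
  ( ( (λ L σ H Lσ Hσ → cayleyForms-∼ (Lσ⇒cayleyForm Lσ) (Lσ⇒cayleyForm Hσ))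
    , (cayley , proj₁ cayley-Lσ , cayley , (cyc (suc n) , cayley-Lσ) , ∼-refl)
    , (λ L L' L∈G L'∈G → cayleyForms-∼ (InG⇒cayleyForm L∈G) (InG⇒cayleyForm L'∈G)) )
  , (λ L σ Lσ → mk⇔ (cayleyForm-disjointTransversals (Lσ⇒cayleyForm Lσ))
                    (λ (T , T-transversal , _) → T Fin.zero , T-transversal Fin.zero))
  , (λ 2∤k L L∈G → map₂ (map₁ cayleyForm⇒InG) (cayleyForm-orthogonalMate 2∤k (InG⇒cayleyForm L∈G)))
  , (λ 2∣k L L∈G L' L'-latin L⊥L' →
       cayleyForm-noTransversal 2∣k (InG⇒cayleyForm L∈G) (orthogonal⇒transversal L'-latin L⊥L')) )
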